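{- Let $k\ge 2$ and let $G$ be a $P_k$-homomorphism-saturated digraph on $n$ vertices, with vertex classes $G_1,\dots,G_{k-1}$. Then \[e(G)=\frac12\left(n^2-\sum_{i=1}^{k-1}|G_i|^2\right),\] where $e(G)$ is the number of arcs of $G$.
   Context: Digraphs have no loops. $P_k$ is the directed path on $k$ vertices. A digraph homomorphism $F\to G$ is a vertex map sending arcs to arcs; $G$ is $P_k$-homomorphism-free if there is no homomorphism $P_k\to G$. $G$ on vertex set $V$ is $P_k$-homomorphism-saturated if it is $P_k$-homomorphism-free and adding any ordered pair of distinct vertices not already an arc creates a homomorphism from $P_k$. The vertex classes are defined by: $G_i$ is the set of vertices $v$ such that the longest directed path in $G$ terminating at $v$ has exactly $i-1$ arcs. -}

module Defs where

open import Data.Nat using (ℕ; zero; suc; _+_; _*_; _≤_)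
open import Data.Bool using (Bool; true; false; _∨_; _∧_; if_then_else_)
open import Data.Fin using (Fin; zero; suc; toℕ; fromℕ)
open import Data.Fin.Properties using (_≟_)
open import Data.Nat.Properties using () renaming (_≟_ to _≟ℕ_)
open import Data.Product using (Σ; _×_)
open import Data.Empty using (⊥)
open import Function.Definitions using (Injective)
open import Relation.Binary.PropositionalEquality using (_≡_; _≢_)
open import Relation.Nullary using (¬_)
open import Relation.Nullary.Decidable using (⌊_⌋)

record Digraph (n : ℕ) : Set where
  field
    arc      : Fin n → Fin n → Bool
    loopless : ∀ v → arc v v ≡ false
open Digraph public

sumFin : (m : ℕ) → (Fin m → ℕ) → ℕ
sumFin zero    f = 0
sumFin (suc m) f = f zero + sumFin m (λ i → f (suc i))

count : ∀ {n} → (Fin n → Bool) → ℕ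
count {n} p = sumFin n (λ i → if p i then 1 else 0)

numArcs : ∀ {n} → Digraph n → ℕ
numArcs {n} G = sumFin n (λ u → count (λ v → arc G u v))

PkHom : ∀ {n} → (k : ℕ) → (Fin n → Fin n → Bool) → Set
PkHom {n} k R =
  Σ (Fin k → Fin n) λ f →
    ∀ (i j : Fin k) → toℕ j ≡ suc (toℕ i) → R (f i) (f j) ≡ true

PkHomFree : ∀ {n} → ℕ → Digraph n → Set
PkHomFree k G = ¬ PkHom k (arc G)

addArc : ∀ {n} → Digraph n → Fin n → Fin n → (Fin n → Fin n → Bool)
addArc G u v x y = arc G x y ∨ (⌊ x ≟ u ⌋ ∧ ⌊ y ≟ v ⌋)

PkHomSaturated : ∀ {n} → ℕ → Digraph n → Set
PkHomSaturated {n} k G =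
  PkHomFree k G ×
  (∀ (u v : Fin n) → u ≢ v → arc G u v ≡ false → PkHom k (addArc G u v))

PathEndingAt : ∀ {n} → Digraph n → ℕ → Fin n → Set
PathEndingAt {n} G m v =
  Σ (Fin (suc m) → Fin n) λ f →
    Injective _≡_ _≡_ f ×
    (∀ (i j : Fin (suc m)) → toℕ j ≡ suc (toℕ i) → arc G (f i) (f j) ≡ true) ×
    f (fromℕ m) ≡ v

IsLongestPathLength : ∀ {n} → Digraph n → (Fin n → ℕ) → Set
IsLongestPathLength {n} G h =
  ∀ (v : Fin n) → PathEndingAt G (h v) v × (∀ m → PathEndingAt G m v → m ≤ h v)

-- |G_i| where G_i = { v : longest path terminating at v has exactly i-1 arcs },
-- expressed via the longest-path-length function h; here i ≥ 1.
classSize : ∀ {n} → (Fin n → ℕ) → ℕ → ℕ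
classSize h i = count (λ v → ⌊ suc (h v) ≟ℕ i ⌋)

-- In a P_k-free digraph the longest-path length h strictly increases along arcs: an arc u → v
-- either extends a longest path ending at u to a longer path ending at v, or it closes a cycle,
-- and a cycle receives homomorphisms from paths of every length. Saturation gives the converse:
-- adding a missing arc u → v with h u < h v keeps h strictly increasing with values below k - 1,
-- and such a potential rules out a homomorphism from P_k. So the arcs are exactly the pairs with
-- h u < h v. Of the n² ordered pairs of vertices, as many have h u > h v, and those with
-- h u = h v number Σ |G_i|².

module Submission where

open import Defs
open import Algebra.Properties.CommutativeSemigroup using (interchange)
open import Data.Bool.Base using (Bool; true; false; T; if_then_else_)
open import Data.Empty using (⊥-elim)
open import Data.Fin.Base as Fin using (Fin; zero; suc; toℕ; fromℕ; inject₁; inject≤)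
open import Data.Fin.Properties
  using ( _≟_; any?; toℕ-fromℕ; toℕ-inject₁; toℕ-inject≤; toℕ-injective; toℕ<n
        ; ≤fromℕ; ≤∧≢⇒<)
open import Data.Nat.Base
  using (ℕ; zero; suc; _+_; _*_; _≤_; _<_; _∸_; _<ᵇ_; _≡ᵇ_; s≤s; s<s⁻¹)
open import Data.Nat.Properties
  using ( +-commutativeSemigroup; +-identityʳ; +-suc; *-identityʳ; *-zeroʳ; *-distribʳ-+
        ; ≤-refl; ≤-reflexive; ≤-trans; +-monoˡ-≤; m≤n+m; <⇒≱; <⇒≢; ≰⇒>; <-irrefl
        ; <⇒<ᵇ; <ᵇ⇒<; suc-injective; module ≤-Reasoning)
  renaming (_≟_ to _≟ℕ_)
open import Data.Product using (Σ; _×_; _,_; proj₁; proj₂)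
open import Data.Unit.Base using (tt)
open import Data.Vec.Functional using (Vector; _∷_; tail)
open import Function.Base using (_∘_)
open import Function.Definitions using (Injective)
open import Relation.Binary.PropositionalEquality
  using (_≡_; _≢_; refl; sym; trans; cong; cong₂; subst; subst₂; module ≡-Reasoning)
open import Relation.Nullary using (¬_; yes; no)
open import Relation.Nullary.Decidable using (isYes≗does)
open import Relation.Nullary.Negation using (contradiction)

indicator : Bool → ℕ
indicator b = if b then 1 else 0

sumFin-cong : ∀ m {f g : Fin m → ℕ} → (∀ i → f i ≡ g i) → sumFin m f ≡ sumFin m g
sumFin-cong zero    f≗g = refl
sumFin-cong (suc m) f≗g = cong₂ _+_ (f≗g zero) (sumFin-cong m (f≗g ∘ suc))

sumFin-const : ∀ m c → sumFin m (λ _ → c) ≡ m * c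
sumFin-const zero    c = refl
sumFin-const (suc m) c = cong (c +_) (sumFin-const m c)

sumFin-distrib-+ : ∀ m (f g : Fin m → ℕ) →
  sumFin m (λ i → f i + g i) ≡ sumFin m f + sumFin m g
sumFin-distrib-+ zero    f g = refl
sumFin-distrib-+ (suc m) f g =
  trans (cong (f zero + g zero +_) (sumFin-distrib-+ m (f ∘ suc) (g ∘ suc)))
        (interchange +-commutativeSemigroup (f zero) (g zero) _ _)

sumFin-distribʳ-* : ∀ m (f : Fin m → ℕ) c → sumFin m f * c ≡ sumFin m (λ i → f i * c)
sumFin-distribʳ-* zero    f c = refl
sumFin-distribʳ-* (suc m) f c =
  trans (*-distribʳ-+ c (f zero) _) (cong (f zero * c +_) (sumFin-distribʳ-* m (f ∘ suc) c))

sumFin-comm : ∀ m p (f : Fin m → Fin p → ℕ) →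
  sumFin m (λ i → sumFin p (f i)) ≡ sumFin p (λ j → sumFin m (λ i → f i j))
sumFin-comm zero    p f = sym (trans (sumFin-const p 0) (*-zeroʳ p))
sumFin-comm (suc m) p f =
  trans (cong (sumFin p (f zero) +_) (sumFin-comm m p (f ∘ suc)))
        (sym (sumFin-distrib-+ p (f zero) _))

sumFin-indicator-≡ᵇ : ∀ K a → a < K → (x : ℕ → ℕ) →
  sumFin K (λ j → indicator (a ≡ᵇ toℕ j) * x (toℕ j)) ≡ x a
sumFin-indicator-≡ᵇ (suc K) zero    _       x =
  trans (cong₂ _+_ (+-identityʳ (x 0)) (trans (sumFin-const K 0) (*-zeroʳ K)))
        (+-identityʳ (x 0))
sumFin-indicator-≡ᵇ (suc K) (suc a) (s≤s a<K) x = sumFin-indicator-≡ᵇ K a a<K (x ∘ suc)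

indicator-trichotomy : ∀ a b →
  indicator (a <ᵇ b) + indicator (b <ᵇ a) + indicator (b ≡ᵇ a) ≡ 1
indicator-trichotomy zero    zero    = refl
indicator-trichotomy zero    (suc b) = refl
indicator-trichotomy (suc a) zero    = refl
indicator-trichotomy (suc a) (suc b) = indicator-trichotomy a b

module _ {n} (h : Fin n → ℕ) where

  levelSize : ℕ → ℕ
  levelSize a = count (λ v → h v ≡ᵇ a)

  sumOfLevelSquares : ℕ → ℕ
  sumOfLevelSquares K = sumFin K (λ j → levelSize (toℕ j) * levelSize (toℕ j))

  ascendingPairs descendingPairs levelPairs : ℕ
  ascendingPairs  = sumFin n (λ u → count (λ v → h u <ᵇ h v))
  descendingPairs = sumFin n (λ u → count (λ v → h v <ᵇ h u))
  levelPairs      = sumFin n (λ u → levelSize (h u))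

  count-trichotomy : ∀ a →
    count (λ v → a <ᵇ h v) + count (λ v → h v <ᵇ a) + levelSize a ≡ n
  count-trichotomy a = begin
    count (λ v → a <ᵇ h v) + count (λ v → h v <ᵇ a) + levelSize a
      ≡⟨ cong (_+ levelSize a) (sumFin-distrib-+ n _ _) ⟨
    sumFin n (λ v → indicator (a <ᵇ h v) + indicator (h v <ᵇ a)) + levelSize a
      ≡⟨ sumFin-distrib-+ n _ _ ⟨
    sumFin n (λ v → indicator (a <ᵇ h v) + indicator (h v <ᵇ a) + indicator (h v ≡ᵇ a))
      ≡⟨ sumFin-cong n (λ v → indicator-trichotomy a (h v)) ⟩
    sumFin n (λ _ → 1)
      ≡⟨ sumFin-const n 1 ⟩
    n * 1
      ≡⟨ *-identityʳ n ⟩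
    n ∎
    where open ≡-Reasoning

  ascending+descending+level≡n² : ascendingPairs + descendingPairs + levelPairs ≡ n * n
  ascending+descending+level≡n² = begin
    ascendingPairs + descendingPairs + levelPairs
      ≡⟨ cong (_+ levelPairs) (sumFin-distrib-+ n _ _) ⟨
    sumFin n (λ u → count (λ v → h u <ᵇ h v) + count (λ v → h v <ᵇ h u)) + levelPairs
      ≡⟨ sumFin-distrib-+ n _ _ ⟨
    sumFin n (λ u → count (λ v → h u <ᵇ h v) + count (λ v → h v <ᵇ h u) + levelSize (h u))
      ≡⟨ sumFin-cong n (λ u → count-trichotomy (h u)) ⟩
    sumFin n (λ _ → n)
      ≡⟨ sumFin-const n n ⟩
    n * n ∎
    where open ≡-Reasoning

  descendingPairs≡ascendingPairs : descendingPairs ≡ ascendingPairs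
  descendingPairs≡ascendingPairs = sumFin-comm n n (λ u v → indicator (h v <ᵇ h u))

  levelPairs≡sumOfLevelSquares : ∀ K → (∀ v → h v < K) → levelPairs ≡ sumOfLevelSquares K
  levelPairs≡sumOfLevelSquares K h<K = begin
    sumFin n (λ u → levelSize (h u))
      ≡⟨ sumFin-cong n (λ u → sumFin-indicator-≡ᵇ K (h u) (h<K u) levelSize) ⟨
    sumFin n (λ u → sumFin K (λ j → indicator (h u ≡ᵇ toℕ j) * levelSize (toℕ j)))
      ≡⟨ sumFin-comm n K _ ⟩
    sumFin K (λ j → sumFin n (λ u → indicator (h u ≡ᵇ toℕ j) * levelSize (toℕ j)))
      ≡⟨ sumFin-cong K (λ j → sumFin-distribʳ-* n _ (levelSize (toℕ j))) ⟨
    sumFin K (λ j → levelSize (toℕ j) * levelSize (toℕ j)) ∎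
    where open ≡-Reasoning

  2*ascendingPairs+sumOfLevelSquares≡n² : ∀ K → (∀ v → h v < K) →
    2 * ascendingPairs + sumOfLevelSquares K ≡ n * n
  2*ascendingPairs+sumOfLevelSquares≡n² K h<K = begin
    ascendingPairs + (ascendingPairs + 0) + sumOfLevelSquares K
      ≡⟨ cong₂ (λ a b → ascendingPairs + a + b)
               (trans (+-identityʳ ascendingPairs) (sym descendingPairs≡ascendingPairs))
               (sym (levelPairs≡sumOfLevelSquares K h<K)) ⟩
    ascendingPairs + descendingPairs + levelPairs
      ≡⟨ ascending+descending+level≡n² ⟩
    n * n ∎
    where open ≡-Reasoning

-- ⌊_⌋ is stuck on the Dec built by _≟ℕ_, whereas its does-field computes to a ≡ᵇ b.
classSize≡levelSize : ∀ {n} (h : Fin n → ℕ) a → classSize h (suc a) ≡ levelSize h a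
classSize≡levelSize {n} h a =
  sumFin-cong n (λ v → cong indicator (isYes≗does (suc (h v) ≟ℕ suc a)))

_∷ʳ_ : ∀ {A : Set} {m} → Vector A m → A → Vector A (suc m)
_∷ʳ_ {m = zero}  xs x _       = x
_∷ʳ_ {m = suc m} xs x zero    = xs zero
_∷ʳ_ {m = suc m} xs x (suc i) = (tail xs ∷ʳ x) i

∷ʳ-inject₁ : ∀ {A : Set} {m} (xs : Vector A m) x i → (xs ∷ʳ x) (inject₁ i) ≡ xs i
∷ʳ-inject₁ {m = suc m} xs x zero    = refl
∷ʳ-inject₁ {m = suc m} xs x (suc i) = ∷ʳ-inject₁ (tail xs) x i

∷ʳ-fromℕ : ∀ {A : Set} {m} (xs : Vector A m) x → (xs ∷ʳ x) (fromℕ m) ≡ x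
∷ʳ-fromℕ {m = zero}  xs x = refl
∷ʳ-fromℕ {m = suc m} xs x = ∷ʳ-fromℕ (tail xs) x

data InitOrLast : ∀ {m} → Fin (suc m) → Set where
  init : ∀ {m} (i : Fin m) → InitOrLast (inject₁ i)
  last : ∀ {m} → InitOrLast (fromℕ m)

initOrLast : ∀ {m} (i : Fin (suc m)) → InitOrLast i
initOrLast {zero}  zero    = last
initOrLast {suc m} zero    = init zero
initOrLast {suc m} (suc i) with initOrLast i
... | init j = init (suc j)
... | last   = last

∷ʳ-injective : ∀ {A : Set} {m} {xs : Vector A m} {x} →
  Injective _≡_ _≡_ xs → (∀ i → xs i ≢ x) → Injective _≡_ _≡_ (xs ∷ʳ x)
∷ʳ-injective {xs = xs} {x} inj x∉xs {i} {j} eq with initOrLast i | initOrLast j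
... | last    | last    = refl
... | last    | init j′ rewrite ∷ʳ-fromℕ xs x | ∷ʳ-inject₁ xs x j′ =
  ⊥-elim (x∉xs j′ (sym eq))
... | init i′ | last    rewrite ∷ʳ-fromℕ xs x | ∷ʳ-inject₁ xs x i′ =
  ⊥-elim (x∉xs i′ eq)
... | init i′ | init j′ rewrite ∷ʳ-inject₁ xs x i′ | ∷ʳ-inject₁ xs x j′ =
  cong inject₁ (inj eq)

-- PkHom k R is definitionally Σ (Fin k → Fin n) (IsPkHom R).
IsPkHom : ∀ {n m} → (Fin n → Fin n → Bool) → (Fin m → Fin n) → Set
IsPkHom R f = ∀ i j → toℕ j ≡ suc (toℕ i) → R (f i) (f j) ≡ true

module _ {n} {R : Fin n → Fin n → Bool} where

  IsPkHom-inject≤ : ∀ {k m} {f : Fin m → Fin n} → IsPkHom R f → (k≤m : k ≤ m) →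
    IsPkHom R (λ i → f (inject≤ i k≤m))
  IsPkHom-inject≤ hom k≤m i j j≡1+i = hom _ _ (begin
    toℕ (inject≤ j k≤m)       ≡⟨ toℕ-inject≤ j k≤m ⟩
    toℕ j                     ≡⟨ j≡1+i ⟩
    suc (toℕ i)               ≡⟨ cong suc (toℕ-inject≤ i k≤m) ⟨
    suc (toℕ (inject≤ i k≤m)) ∎)
    where open ≡-Reasoning

  IsPkHom-∷ : ∀ {m x} {f : Fin (suc m) → Fin n} →
    R x (f zero) ≡ true → IsPkHom R f → IsPkHom R (x ∷ f)
  IsPkHom-∷ x→f₀ hom zero    (suc zero)    _     = x→f₀
  IsPkHom-∷ x→f₀ hom (suc i) (suc j)       j≡1+i = hom i j (suc-injective j≡1+i)

  IsPkHom-tail : ∀ {m} {f : Fin (suc m) → Fin n} → IsPkHom R f → IsPkHom R (f ∘ suc)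
  IsPkHom-tail hom i j j≡1+i = hom (suc i) (suc j) (cong suc j≡1+i)

  IsPkHom-∷ʳ : ∀ {m x} {f : Fin (suc m) → Fin n} →
    IsPkHom R f → R (f (fromℕ m)) x ≡ true → IsPkHom R (f ∷ʳ x)
  IsPkHom-∷ʳ {m} {x} {f} hom last→x i j j≡1+i with initOrLast i | initOrLast j
  ... | last    | _ =
    ⊥-elim (<⇒≢ (toℕ<n j) (trans j≡1+i (cong suc (toℕ-fromℕ (suc m)))))
  ... | init i′ | last rewrite ∷ʳ-inject₁ f x i′ | ∷ʳ-fromℕ f x =
    subst (λ l → R (f l) x ≡ true) (sym i′≡last) last→x
    where
    i′≡last : i′ ≡ fromℕ m
    i′≡last = toℕ-injective (suc-injective (begin
      suc (toℕ i′)           ≡⟨ cong suc (toℕ-inject₁ i′) ⟨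
      suc (toℕ (inject₁ i′)) ≡⟨ j≡1+i ⟨
      toℕ (fromℕ (suc m))    ∎))
      where open ≡-Reasoning
  ... | init i′ | init j′ rewrite ∷ʳ-inject₁ f x i′ | ∷ʳ-inject₁ f x j′ =
    hom i′ j′ (trans (sym (toℕ-inject₁ j′)) (trans j≡1+i (cong suc (toℕ-inject₁ i′))))

  ¬PkHom-of-increasingPotential : ∀ k (φ : Fin n → ℕ) →
    (∀ x y → R x y ≡ true → φ x < φ y) → (∀ x → φ x < k) → ¬ PkHom (suc k) R
  ¬PkHom-of-increasingPotential k φ increasing φ<k (f , hom) =
    <⇒≱ (φ<k (f (fromℕ k))) (≤-trans (m≤n+m k _) (climb k f hom))
    where
    climb : ∀ m (f : Fin (suc m) → Fin n) → IsPkHom R f → φ (f zero) + m ≤ φ (f (fromℕ m))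
    climb zero    f hom = ≤-reflexive (+-identityʳ _)
    climb (suc m) f hom = begin
      φ (f zero) + suc m    ≡⟨ +-suc (φ (f zero)) m ⟩
      suc (φ (f zero)) + m  ≤⟨ +-monoˡ-≤ m (increasing _ _ (hom zero (suc zero) refl)) ⟩
      φ (f (suc zero)) + m  ≤⟨ climb m (f ∘ suc) (IsPkHom-tail hom) ⟩
      φ (f (suc (fromℕ m))) ∎
      where open ≤-Reasoning

  HasPredecessorsIn : (Fin n → Set) → Set
  HasPredecessorsIn C = ∀ x → C x → Σ (Fin n) λ y → C y × R y x ≡ true

  PkHom-of-predecessors : (C : Fin n → Set) → HasPredecessorsIn C →
    ∀ x → C x → ∀ k → PkHom k R
  PkHom-of-predecessors C pred x Cx zero    = (λ ()) , λ ()
  PkHom-of-predecessors C pred x Cx (suc k) = let f , hom , _ = homStartingIn k in f , hom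
    where
    homStartingIn : ∀ m → Σ (Fin (suc m) → Fin n) λ f → IsPkHom R f × C (f zero)
    homStartingIn zero    = (λ _ → x) , (λ { zero zero () }) , Cx
    homStartingIn (suc m) with homStartingIn m
    ... | f , hom , Cf₀ with pred (f zero) Cf₀
    ...   | y , Cy , y→f₀ = y ∷ f , IsPkHom-∷ y→f₀ hom , Cy

  PkHom-of-cycle : ∀ {m} {f : Fin (suc m) → Fin n} (i₀ : Fin (suc m)) →
    IsPkHom R f → R (f (fromℕ m)) (f i₀) ≡ true → ∀ k → PkHom k R
  PkHom-of-cycle {m} {f} i₀ hom last→i₀ =
    PkHom-of-predecessors OnCycle predecessor (f i₀) (i₀ , ≤-refl , refl)
    where
    OnCycle : Fin n → Set
    OnCycle x = Σ (Fin (suc m)) λ j → i₀ Fin.≤ j × f j ≡ x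
    predecessor : HasPredecessorsIn OnCycle
    predecessor _ (j , i₀≤j , refl) with i₀ ≟ j
    ... | yes refl = f (fromℕ m) , (fromℕ m , ≤fromℕ i₀ , refl) , last→i₀
    ... | no i₀≢j with j | ≤∧≢⇒< i₀≤j i₀≢j
    ...   | suc j′ | s≤s i₀≤j′ =
      f (inject₁ j′) , (inject₁ j′ , subst (toℕ i₀ ≤_) (sym (toℕ-inject₁ j′)) i₀≤j′ , refl) ,
      hom (inject₁ j′) (suc j′) (cong suc (sym (toℕ-inject₁ j′)))

module _ {n k} (G : Digraph n) (free : PkHomFree k G)
         (h : Fin n → ℕ) (longest : IsLongestPathLength G h) where

  suc[h]<k : ∀ v → suc (h v) < k
  suc[h]<k v with longest v
  ... | (_ , _ , hom , _) , _ = ≰⇒> λ k≤1+h → free (_ , IsPkHom-inject≤ {R = arc G} hom k≤1+h)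

  arc⇒h<h : ∀ {u v} → arc G u v ≡ true → h u < h v
  arc⇒h<h {u} {v} u→v with longest u
  ... | (f , f-injective , hom , f-last) , _ with any? (λ i → f i ≟ v)
  ... | no v∉f = proj₂ (longest v) (suc (h u)) pathToV
    where
    pathToV : PathEndingAt G (suc (h u)) v
    pathToV = f ∷ʳ v
            , ∷ʳ-injective f-injective (λ i fi≡v → v∉f (i , fi≡v))
            , IsPkHom-∷ʳ {R = arc G} hom (subst (λ w → arc G w v ≡ true) (sym f-last) u→v)
            , ∷ʳ-fromℕ f v
  ... | yes (i , fi≡v) = ⊥-elim (free (PkHom-of-cycle {R = arc G} i hom closing k))
    where
    closing : arc G (f (fromℕ (h u))) (f i) ≡ true
    closing = subst₂ (λ a b → arc G a b ≡ true) (sym f-last) (sym fi≡v) u→v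

addArc-increasing : ∀ {n} (G : Digraph n) (φ : Fin n → ℕ) {u v} →
  (∀ x y → arc G x y ≡ true → φ x < φ y) → φ u < φ v →
  ∀ x y → addArc G u v x y ≡ true → φ x < φ y
addArc-increasing G φ {u} {v} increasing φu<φv x y x→y
  with arc G x y in x→y∈G | x ≟ u | y ≟ v
... | true  | _        | _        = increasing x y x→y∈G
... | false | yes refl | yes refl = φu<φv
... | false | yes _    | no _     = contradiction x→y λ ()
... | false | no _     | _        = contradiction x→y λ ()

module _ {n k} (G : Digraph n) (saturated : PkHomSaturated (suc k) G)
         (h : Fin n → ℕ) (longest : IsLongestPathLength G h) where

  private
    free = proj₁ saturated

  h<k : ∀ v → h v < k
  h<k v = s<s⁻¹ (suc[h]<k G free h longest v)

  arc≡h<ᵇh : ∀ u v → arc G u v ≡ (h u <ᵇ h v)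
  arc≡h<ᵇh u v with arc G u v in u→v | h u <ᵇ h v in hu<ᵇhv
  ... | true  | true  = refl
  ... | false | false = refl
  ... | true  | false = ⊥-elim (subst T hu<ᵇhv (<⇒<ᵇ (arc⇒h<h G free h longest u→v)))
  ... | false | true  =
    ⊥-elim (¬PkHom-of-increasingPotential {R = addArc G u v} k h
             (addArc-increasing G h (λ _ _ → arc⇒h<h G free h longest) hu<hv) h<k
             (proj₂ saturated u v u≢v u→v))
    where
    hu<hv : h u < h v
    hu<hv = <ᵇ⇒< (h u) (h v) (subst T (sym hu<ᵇhv) tt)
    u≢v : u ≢ v
    u≢v refl = <-irrefl refl hu<hv

  numArcs≡ascendingPairs : numArcs G ≡ ascendingPairs h
  numArcs≡ascendingPairs =
    sumFin-cong n (λ u → sumFin-cong n (λ v → cong indicator (arc≡h<ᵇh u v)))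

mainTheorem4 : (k n : ℕ) → 2 ≤ k → (G : Digraph n) → PkHomSaturated k G →
    (h : Fin n → ℕ) → IsLongestPathLength G h →
    2 * numArcs G + sumFin (k ∸ 1) (λ j → classSize h (suc (toℕ j)) * classSize h (suc (toℕ j))) ≡ n * n
mainTheorem4 (suc (suc k)) n (s≤s (s≤s _)) G saturated h longest = begin
  2 * numArcs G + sumFin (suc k) (λ j → classSize h (suc (toℕ j)) * classSize h (suc (toℕ j)))
    ≡⟨ cong₂ (λ a b → 2 * a + b) (numArcs≡ascendingPairs G saturated h longest)
             (sumFin-cong (suc k) λ j → cong₂ _*_ (classSize≡levelSize h (toℕ j))
                                                  (classSize≡levelSize h (toℕ j))) ⟩
  2 * ascendingPairs h + sumOfLevelSquares h (suc k)
    ≡⟨ 2*ascendingPairs+sumOfLevelSquares≡n² h (suc k) (h<k G saturated h longest) ⟩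
  n * n ∎
  where open ≡-Reasoning
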